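{- Let $D$ be a directed graph of order $n$ with strong diameter $2$. Then $\pi(D)<\frac{3}{2}n$. Further, this bound is sharp: for every positive integer $k$ there is a directed graph with strong diameter $2$ on $n=2k+1$ vertices whose pebbling number is $3k+1$, the largest integer less than $\frac32 n$.
   Context: Directed graphs are loopless and may contain both arcs $i\to j$ and $j\to i$. $D$ has strong diameter $2$ if for every ordered pair of distinct vertices $(i,j)$ there is a directed path from $i$ to $j$ of length at most $2$. A configuration is a function $C:V(D)\to\mathbb{N}$; its size is $\sum_v C(v)$. A pebbling move along an arc $i\to j$ removes two pebbles from $i$ and adds one pebble to $j$. Given a root $r$, a configuration is $r$-solvable if some sequence (possibly empty) of pebbling moves places a pebble on $r$. The pebbling number $\pi(D)$ is the minimum $t$ such that every configuration of size $t$ is $r$-solvable for every root $r$. -}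

module Defs where

open import Data.Nat using (ℕ; zero; suc; _+_; _*_; _∸_; _≤_; _<_)
open import Data.Fin using (Fin)
open import Data.Fin.Properties using (_≟_)
open import Data.Bool using (Bool; true; false; T)
open import Data.Product using (Σ; ∃; _×_; _,_)
open import Data.Sum using (_⊎_)
open import Relation.Nullary using (¬_; yes; no)
open import Relation.Binary.PropositionalEquality using (_≡_; _≢_)
open import Relation.Binary.Construct.Closure.ReflexiveTransitive using (Star)
import Data.Vec.Functional as VF

record Digraph (n : ℕ) : Set where
  field
    arc      : Fin n → Fin n → Bool
    loopless : ∀ i → arc i i ≡ false
open Digraph public

Arc : ∀ {n} → Digraph n → Fin n → Fin n → Set
Arc D i j = T (arc D i j)

PathLen≤2 : ∀ {n} → Digraph n → Fin n → Fin n → Set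
PathLen≤2 D i j = Arc D i j ⊎ (∃ λ k → Arc D i k × Arc D k j)

StrongDiameter2 : ∀ {n} → Digraph n → Set
StrongDiameter2 D = ∀ i j → i ≢ j → PathLen≤2 D i j

Config : ℕ → Set
Config n = Fin n → ℕ

size : ∀ {n} → Config n → ℕ
size C = VF.foldr _+_ 0 C

update : ∀ {n} → Config n → Fin n → Fin n → Config n
update C i j v with v ≟ i | v ≟ j
... | yes _ | _     = C v ∸ 2
... | no _  | yes _ = C v + 1
... | no _  | no _  = C v

data Move {n} (D : Digraph n) : Config n → Config n → Set where
  move : ∀ (C : Config n) i j → Arc D i j → 2 ≤ C i → Move D C (update C i j)

Solvable : ∀ {n} → Digraph n → Fin n → Config n → Set
Solvable D r C = ∃ λ C' → Star (Move D) C C' × 1 ≤ C' r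

AllSolvable : ∀ {n} → Digraph n → ℕ → Set
AllSolvable D t = ∀ (C : Config _) → size C ≡ t → ∀ r → Solvable D r C

IsPebblingNumber : ∀ {n} → Digraph n → ℕ → Set
IsPebblingNumber D t = AllSolvable D t × (∀ s → s < t → ¬ AllSolvable D s)

-- Let C be an r-unsolvable configuration on a digraph of strong
-- diameter 2. Then r is empty, no vertex holds four pebbles, and every vertex v
-- holding two or three pebbles has a path v → k → r through an empty vertex k;
-- two such vertices cannot share k, since together they would put two pebbles
-- on k. Charging 2 C(u) + 3 [u is r or such a k] ≤ 3 + 3 [C(u) ≥ 2] at every
-- vertex and summing gives 2 |C| + 3 ≤ 3 n. So every configuration of size at
-- least (3n − 2)/2 is solvable, and as solvability is decidable the pebbling
-- number exists and is below 3n/2.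
--
-- Call a configuration stuck if every vertex with two or more pebbles
-- has at most three and sends pebbles only to empty non-root vertices that no
-- other such vertex feeds. Moves preserve this, so a stuck configuration never
-- reaches the root. On the digraph below, three pebbles on each b i is stuck,
-- and so is every configuration of size at most 3k beneath it.

module Submission where

open import Defs
open import Data.Bool using (Bool; true; false; T; not; if_then_else_)
open import Data.Fin using (Fin; zero; suc; _↑ˡ_; _↑ʳ_; splitAt; join)
open import Data.Fin.Properties using (_≟_; any?; all?; suc-injective; splitAt-↑ˡ; splitAt-↑ʳ; join-splitAt)
open import Data.Nat using (ℕ; zero; suc; _+_; _*_; _∸_; _≤_; _<_; z≤n; s≤s; _≤?_)
open import Data.Nat.Properties hiding (_≟_; suc-injective)
open import Data.Nat.Tactic.RingSolver using (solve-∀)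
open import Data.Product using (Σ; ∃; _×_; _,_; proj₁; proj₂)
import Data.Product as Product
open import Data.Sum using (_⊎_; inj₁; inj₂; [_,_]′)
import Data.Sum as Sum
open import Data.Vec.Functional using ([]; _∷_)
open import Function using (_∘_; id)
open import Relation.Nullary using (¬_; Dec; yes; no; does; contradiction)
open import Relation.Nullary.Decidable using (map′; T?; ⌊_⌋; toWitness; fromWitness; fromWitnessFalse)
open import Relation.Binary.PropositionalEquality
open import Relation.Binary.Construct.Closure.ReflexiveTransitive using (Star; ε; _◅_)
open import Algebra.Properties.Semiring.Sum +-*-semiring using (sum-cong-≗; ∑-distrib-+; ∑-comm; *-distribˡ-sum)

private variable
  n : ℕ

size-const : ∀ n c → size {n} (λ _ → c) ≡ n * c
size-const zero    c = refl
size-const (suc n) c = cong (c +_) (size-const n c)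

size-zero : (f : Config n) → (∀ i → f i ≡ 0) → size f ≡ 0
size-zero {n} f f≡0 = trans (sum-cong-≗ f≡0) (trans (size-const n 0) (*-zeroʳ n))

size-scale : ∀ c (f : Config n) → size (λ i → c * f i) ≡ c * size f
size-scale c f = sym (*-distribˡ-sum c f)

size-mono : {f g : Config n} → (∀ i → f i ≤ g i) → size f ≤ size g
size-mono {zero}  f≤g = z≤n
size-mono {suc n} f≤g = +-mono-≤ (f≤g zero) (size-mono (f≤g ∘ suc))

size-↑ : ∀ m n (f : Config (m + n)) → size f ≡ size (f ∘ (_↑ˡ n)) + size (f ∘ (m ↑ʳ_))
size-↑ zero    n f = refl
size-↑ (suc m) n f = trans (cong (f zero +_) (size-↑ m n (f ∘ suc))) (sym (+-assoc (f zero) _ _))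

size-pos⇒∃-pos : (f : Config n) → 1 ≤ size f → ∃ λ i → 1 ≤ f i
size-pos⇒∃-pos {suc n} f 1≤Σf with f zero in f0≡
... | suc _ = zero , subst (1 ≤_) (sym f0≡) (s≤s z≤n)
... | zero  = Product.map suc id (size-pos⇒∃-pos (f ∘ suc) 1≤Σf)

size≤1 : (f : Config n) → (∀ i → f i ≤ 1) → (∀ i j → 1 ≤ f i → 1 ≤ f j → i ≡ j) → size f ≤ 1
size≤1 {zero}  f f≤1 unique = z≤n
size≤1 {suc n} f f≤1 unique with 1 ≤? f zero
... | no 1≰f0 = subst (λ x → x + size (f ∘ suc) ≤ 1) (sym (n<1⇒n≡0 (≰⇒> 1≰f0)))
                  (size≤1 (f ∘ suc) (f≤1 ∘ suc) λ i j p q → suc-injective (unique (suc i) (suc j) p q))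
... | yes 1≤f0 = begin
  f zero + size (f ∘ suc) ≡⟨ cong (f zero +_) (size-zero (f ∘ suc) tail≡0) ⟩
  f zero + 0              ≡⟨ +-identityʳ (f zero) ⟩
  f zero                  ≤⟨ f≤1 zero ⟩
  1                       ∎
  where
  open ≤-Reasoning
  tail≡0 : ∀ i → f (suc i) ≡ 0
  tail≡0 i = n<1⇒n≡0 (≰⇒> λ 1≤fi → contradiction (unique zero (suc i) 1≤f0 1≤fi) λ ())

∃-subconfig : (C : Config n) (s : ℕ) → s ≤ size C → ∃ λ C′ → size C′ ≡ s × (∀ i → C′ i ≤ C i)
∃-subconfig {zero}  C .zero z≤n = C , refl , λ ()
∃-subconfig {suc n} C s s≤ΣC with s ≤? size (C ∘ suc)
... | yes s≤tail =
  let (C′ , ΣC′≡s , C′≤C) = ∃-subconfig (C ∘ suc) s s≤tail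
  in (0 ∷ C′) , ΣC′≡s , λ { zero → z≤n ; (suc i) → C′≤C i }
... | no s≰tail = (s ∸ t ∷ C ∘ suc) , m∸n+n≡m (<⇒≤ (≰⇒> s≰tail)) ,
                  λ { zero → m≤n+o⇒m∸n≤o s t (subst (s ≤_) (+-comm (C zero) t) s≤ΣC) ; (suc i) → ≤-refl }
  where t = size (C ∘ suc)

indicator : ∀ {a} {A : Set a} → Dec A → ℕ
indicator d = if does d then 1 else 0

indicator≤1 : ∀ {a} {A : Set a} (d : Dec A) → indicator d ≤ 1
indicator≤1 (yes _) = s≤s z≤n
indicator≤1 (no _)  = z≤n

indicator-pos : ∀ {a} {A : Set a} (d : Dec A) → 1 ≤ indicator d → A
indicator-pos (yes a) _ = a

size-indicator : (x : Fin n) → size (λ u → indicator (u ≟ x)) ≡ 1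
size-indicator {suc n} zero = cong suc (size-zero {n} (λ v → indicator (suc v ≟ zero)) λ _ → refl)
size-indicator (suc x)      = size-indicator x

arc⇒≢ : (D : Digraph n) {i j : Fin n} → Arc D i j → i ≢ j
arc⇒≢ D {i} i→j refl = subst T (loopless D i) i→j

module _ (C : Config n) (i j : Fin n) where

  update-source : update C i j i ≡ C i ∸ 2
  update-source with i ≟ i
  ... | yes _  = refl
  ... | no i≢i = contradiction refl i≢i

  update-target : i ≢ j → update C i j j ≡ C j + 1
  update-target i≢j with j ≟ i | j ≟ j
  ... | yes j≡i | _      = contradiction (sym j≡i) i≢j
  ... | no _    | yes _  = refl
  ... | no _    | no j≢j = contradiction refl j≢j

  update-other : ∀ {v} → v ≢ i → v ≢ j → update C i j v ≡ C v
  update-other {v} v≢i v≢j with v ≟ i | v ≟ j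
  ... | yes v≡i | _       = contradiction v≡i v≢i
  ... | no _    | yes v≡j = contradiction v≡j v≢j
  ... | no _    | no _    = refl

  -- i loses two pebbles and j gains one, stated additively to avoid the truncated C i ∸ 2.
  update-balance : i ≢ j → 2 ≤ C i → ∀ v → update C i j v + 2 * indicator (v ≟ i) ≡ C v + indicator (v ≟ j)
  update-balance i≢j 2≤Ci v with v ≟ i | v ≟ j
  ... | yes refl | yes refl = contradiction refl i≢j
  ... | yes refl | no _     = trans (m∸n+n≡m 2≤Ci) (sym (+-identityʳ (C v)))
  ... | no _     | yes _    = +-identityʳ (C v + 1)
  ... | no _     | no _     = refl

  size-update : i ≢ j → 2 ≤ C i → size (update C i j) + 1 ≡ size C
  size-update i≢j 2≤Ci = +-cancelʳ-≡ 1 _ _ (begin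
    size U + 1 + 1                                      ≡⟨ +-assoc (size U) 1 1 ⟩
    size U + 2 * 1                                      ≡⟨ cong (λ x → size U + 2 * x) (size-indicator i) ⟨
    size U + 2 * size (λ v → indicator (v ≟ i))         ≡⟨ cong (size U +_) (size-scale 2 (λ v → indicator (v ≟ i))) ⟨
    size U + size (λ v → 2 * indicator (v ≟ i))         ≡⟨ ∑-distrib-+ U _ ⟨
    size (λ v → U v + 2 * indicator (v ≟ i))            ≡⟨ sum-cong-≗ (update-balance i≢j 2≤Ci) ⟩
    size (λ v → C v + indicator (v ≟ j))                ≡⟨ ∑-distrib-+ C _ ⟩
    size C + size (λ v → indicator (v ≟ j))             ≡⟨ cong (size C +_) (size-indicator j) ⟩
    size C + 1                                          ∎)
    where
    open ≡-Reasoning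
    U = update C i j

update-resp-≗ : {C C′ : Config n} (i j : Fin n) → C ≗ C′ → update C i j ≗ update C′ i j
update-resp-≗ {C = C} {C′} i j C≗C′ v with v ≟ i | v ≟ j
... | yes _ | _     = cong (_∸ 2) (C≗C′ v)
... | no _  | yes _ = cong (_+ 1) (C≗C′ v)
... | no _  | no _  = C≗C′ v

module _ (D : Digraph n) (r : Fin n) where

  solvable-here : {C : Config n} → 1 ≤ C r → Solvable D r C
  solvable-here {C} 1≤Cr = C , ε , 1≤Cr

  solvable-◅ : {C : Config n} {i j : Fin n} → Arc D i j → 2 ≤ C i → Solvable D r (update C i j) → Solvable D r C
  solvable-◅ {C} {i} {j} i→j 2≤Ci (C′ , moves , 1≤C′r) = C′ , move C i j i→j 2≤Ci ◅ moves , 1≤C′r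

  solvable-by-arc : {C : Config n} {v : Fin n} → Arc D v r → 2 ≤ C v → Solvable D r C
  solvable-by-arc {C} {v} v→r 2≤Cv =
    solvable-◅ v→r 2≤Cv (solvable-here (subst (1 ≤_) (sym (update-target C v r (arc⇒≢ D v→r))) (m≤n+m 1 (C r))))

  solvable-by-path : {C : Config n} {v k : Fin n} → Arc D v k → Arc D k r → 2 ≤ C v → 1 ≤ C k → Solvable D r C
  solvable-by-path {C} {v} {k} v→k k→r 2≤Cv 1≤Ck =
    solvable-◅ v→k 2≤Cv (solvable-by-arc k→r (subst (2 ≤_) (sym (update-target C v k (arc⇒≢ D v→k))) (+-monoˡ-≤ 1 1≤Ck)))

  solvable-by-path-4 : {C : Config n} {v k : Fin n} → Arc D v k → Arc D k r → 4 ≤ C v → Solvable D r C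
  solvable-by-path-4 {C} {v} {k} v→k k→r 4≤Cv =
    solvable-◅ v→k (≤-trans (s≤s (s≤s z≤n)) 4≤Cv)
      (solvable-by-path v→k k→r (subst (2 ≤_) (sym (update-source C v k)) (∸-monoˡ-≤ 2 4≤Cv))
        (subst (1 ≤_) (sym (update-target C v k (arc⇒≢ D v→k))) (m≤n+m 1 (C k))))

  solvable-by-merge : {C : Config n} {v w k : Fin n} → v ≢ w → Arc D v k → Arc D w k → Arc D k r →
                      2 ≤ C v → 2 ≤ C w → Solvable D r C
  solvable-by-merge {C} {v} {w} {k} v≢w v→k w→k k→r 2≤Cv 2≤Cw =
    solvable-◅ v→k 2≤Cv
      (solvable-by-path w→k k→r (subst (2 ≤_) (sym (update-other C v k (v≢w ∘ sym) (arc⇒≢ D w→k))) 2≤Cw)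
        (subst (1 ≤_) (sym (update-target C v k (arc⇒≢ D v→k))) (m≤n+m 1 (C k))))

  moves-resp-≗ : {C₁ C₂ C₁′ : Config n} → Star (Move D) C₁ C₂ → C₁ ≗ C₁′ →
                 ∃ λ C₂′ → Star (Move D) C₁′ C₂′ × C₂ ≗ C₂′
  moves-resp-≗ {C₁′ = C₁′} ε C₁≗C₁′ = C₁′ , ε , C₁≗C₁′
  moves-resp-≗ {C₁′ = C₁′} (move C i j i→j 2≤Ci ◅ moves) C≗C₁′ =
    let (C₂′ , moves′ , C₂≗C₂′) = moves-resp-≗ moves (update-resp-≗ i j C≗C₁′)
    in C₂′ , move C₁′ i j i→j (subst (2 ≤_) (C≗C₁′ i) 2≤Ci) ◅ moves′ , C₂≗C₂′

  solvable-resp-≗ : {C C′ : Config n} → C ≗ C′ → Solvable D r C → Solvable D r C′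
  solvable-resp-≗ C≗C′ (C₁ , moves , 1≤C₁r) =
    let (C₁′ , moves′ , C₁≗C₁′) = moves-resp-≗ moves C≗C′ in C₁′ , moves′ , subst (1 ≤_) (C₁≗C₁′ r) 1≤C₁r

  -- Every move loses a pebble, so the search tree below C has depth at most size C.
  solvable? : (C : Config n) → Dec (Solvable D r C)
  solvable? C = search (suc (size C)) C ≤-refl
    where
    search : ∀ fuel (C : Config n) → size C < fuel → Dec (Solvable D r C)
    search (suc fuel) C ΣC<fuel with 1 ≤? C r
    ... | yes 1≤Cr = yes (solvable-here 1≤Cr)
    ... | no 1≰Cr  = map′ (λ (_ , _ , i→j , 2≤Ci , s) → solvable-◅ i→j 2≤Ci s) first-move
                          (any? λ i → any? λ j → step? i j)
      where
      step? : ∀ i j → Dec (Arc D i j × 2 ≤ C i × Solvable D r (update C i j))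
      step? i j with T? (arc D i j) | 2 ≤? C i
      ... | no ¬i→j | _        = no (¬i→j ∘ proj₁)
      ... | yes _   | no 2≰Ci  = no (2≰Ci ∘ proj₁ ∘ proj₂)
      ... | yes i→j | yes 2≤Ci = map′ (λ s → i→j , 2≤Ci , s) (proj₂ ∘ proj₂)
        (search fuel (update C i j)
          (≤-trans (≤-reflexive (trans (+-comm 1 _) (size-update C i j (arc⇒≢ D i→j) 2≤Ci))) (≤-pred ΣC<fuel)))

      first-move : Solvable D r C → ∃ λ i → ∃ λ j → Arc D i j × 2 ≤ C i × Solvable D r (update C i j)
      first-move (_ , ε , 1≤Cr) = contradiction 1≤Cr 1≰Cr
      first-move (C′ , move _ i j i→j 2≤Ci ◅ moves , 1≤C′r) = i , j , i→j , 2≤Ci , C′ , moves , 1≤C′r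

-- Configurations are functions, so enumerating them needs P to respect pointwise equality.
∀-config? : (P : Config n → Set) → (∀ C → Dec (P C)) → (∀ {C C′} → C ≗ C′ → P C → P C′) →
            ∀ s → Dec (∀ C → size C ≡ s → P C)
∀-config? {zero} P P? resp zero = map′ (λ p C _ → resp (λ ()) p) (λ all → all [] refl) (P? [])
∀-config? {zero} P P? resp (suc s) = yes λ _ ()
∀-config? {suc n} P P? resp s = map′ from to (allUpTo? (λ x → ∀-config? (P ∘ (x ∷_)) (P? ∘ (x ∷_)) (resp ∘ ∷-resp x) (s ∸ x)) (suc s))
  where
  ∷-resp : ∀ x {C C′ : Config n} → C ≗ C′ → (x ∷ C) ≗ (x ∷ C′)
  ∷-resp x C≗C′ zero    = refl
  ∷-resp x C≗C′ (suc i) = C≗C′ i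

  from : (∀ {x} → x < suc s → ∀ C → size C ≡ s ∸ x → P (x ∷ C)) → ∀ C → size C ≡ s → P C
  from all C refl = resp (λ { zero → refl ; (suc i) → refl })
    (all (s≤s (m≤m+n (C zero) _)) (C ∘ suc) (sym (m+n∸m≡n (C zero) _)))

  to : (∀ C → size C ≡ s → P C) → ∀ {x} → x < suc s → ∀ C → size C ≡ s ∸ x → P (x ∷ C)
  to all {x} x<1+s C ΣC≡ = all (x ∷ C) (trans (cong (x +_) ΣC≡) (m+[n∸m]≡n (m<1+n⇒m≤n x<1+s)))

allSolvable? : (D : Digraph n) → ∀ s → Dec (AllSolvable D s)
allSolvable? D = ∀-config? (λ C → ∀ r → Solvable D r C) (λ C → all? λ r → solvable? D r C)
                           (λ C≗C′ sol r → solvable-resp-≗ D r C≗C′ (sol r))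

Least : (ℕ → Set) → ℕ → Set
Least P t = P t × (∀ s → s < t → ¬ P s)

least-below : (P : ℕ → Set) → (∀ s → Dec (P s)) → ∀ T → (∃ λ s → s ≤ T × P s) → ∃ λ t → t ≤ T × Least P t
least-below P P? zero (.zero , z≤n , p) = zero , z≤n , p , λ _ ()
least-below P P? (suc T) (s , s≤1+T , p) with anyUpTo? P? (suc T)
... | yes (s′ , s′<1+T , p′) = Product.map₂ (Product.map m≤n⇒m≤1+n id) (least-below P P? T (s′ , m<1+n⇒m≤n s′<1+T , p′))
... | no none = s , s≤1+T , p , λ s′ s′<s p′ → none (s′ , <-≤-trans s′<s s≤1+T , p′)

record HeavyMatching (C : Config n) (r : Fin n) : Set where
  field
    root-empty        : C r ≡ 0
    at-most-3         : ∀ v → C v ≤ 3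
    partner           : ∀ {v} → 2 ≤ C v → Fin n
    partner-empty     : ∀ {v} (p : 2 ≤ C v) → C (partner p) ≡ 0
    partner-≢root     : ∀ {v} (p : 2 ≤ C v) → partner p ≢ r
    partner-injective : ∀ {v w} (p : 2 ≤ C v) (q : 2 ≤ C w) → partner p ≡ partner q → v ≡ w

light-charge : ∀ {c m} → c ≤ 1 → m ≤ 1 → (1 ≤ m → c ≡ 0) → 2 * c + 3 * m ≤ 3
light-charge z≤n       z≤n       _    = z≤n
light-charge z≤n       (s≤s z≤n) _    = ≤-refl
light-charge (s≤s z≤n) z≤n       _    = s≤s (s≤s z≤n)
light-charge (s≤s z≤n) (s≤s z≤n) m⇒c≡0 = contradiction (m⇒c≡0 ≤-refl) λ ()

module _ {C : Config n} {r : Fin n} (M : HeavyMatching C r) where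
  open HeavyMatching M

  is-partner : ∀ {v} → Fin n → Dec (2 ≤ C v) → ℕ
  is-partner u (yes p) = indicator (u ≟ partner p)
  is-partner u (no _)  = 0

  size-is-partner : ∀ {v} (d : Dec (2 ≤ C v)) → size (λ u → is-partner u d) ≡ indicator d
  size-is-partner (yes p) = size-indicator (partner p)
  size-is-partner (no _)  = size-zero {n} (λ _ → 0) λ _ → refl

  is-partner≤1 : ∀ {v} u (d : Dec (2 ≤ C v)) → is-partner u d ≤ 1
  is-partner≤1 u (yes p) = indicator≤1 (u ≟ partner p)
  is-partner≤1 u (no _)  = z≤n

  is-partner-pos : ∀ {v} u (d : Dec (2 ≤ C v)) → 1 ≤ is-partner u d → Σ (2 ≤ C v) λ p → u ≡ partner p
  is-partner-pos u (yes p) 1≤ip = p , indicator-pos (u ≟ partner p) 1≤ip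

  image : Fin n → ℕ
  image u = size (λ v → is-partner u (2 ≤? C v))

  image≤1 : ∀ u → image u ≤ 1
  image≤1 u = size≤1 _ (λ v → is-partner≤1 u (2 ≤? C v)) λ v w 1≤ipv 1≤ipw →
    let (p , u≡pv) = is-partner-pos u (2 ≤? C v) 1≤ipv ; (q , u≡pw) = is-partner-pos u (2 ≤? C w) 1≤ipw
    in partner-injective p q (trans (sym u≡pv) u≡pw)

  image-empty : ∀ u → 1 ≤ image u → C u ≡ 0 × u ≢ r
  image-empty u 1≤im with size-pos⇒∃-pos _ 1≤im
  ... | v , 1≤ip with is-partner-pos u (2 ≤? C v) 1≤ip
  ... | p , refl = partner-empty p , partner-≢root p

  marked : Fin n → ℕ
  marked u = image u + indicator (u ≟ r)

  marked≤1 : ∀ u → marked u ≤ 1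
  marked≤1 u with u ≟ r
  ... | yes refl = subst (λ x → x + 1 ≤ 1) (sym (n<1⇒n≡0 (≰⇒> λ 1≤im → proj₂ (image-empty r 1≤im) refl))) ≤-refl
  ... | no _     = subst (_≤ 1) (sym (+-identityʳ (image u))) (image≤1 u)

  marked-empty : ∀ u → 1 ≤ marked u → C u ≡ 0
  marked-empty u with u ≟ r
  ... | yes refl = λ _ → root-empty
  ... | no _     = λ 1≤m → proj₁ (image-empty u (subst (1 ≤_) (+-identityʳ (image u)) 1≤m))

  charge : ∀ u → 2 * C u + 3 * marked u ≤ 3 + 3 * indicator (2 ≤? C u)
  charge u = charge′ (2 ≤? C u)
    where
    charge′ : (d : Dec (2 ≤ C u)) → 2 * C u + 3 * marked u ≤ 3 + 3 * indicator d
    charge′ (no 2≰Cu) = light-charge (m<1+n⇒m≤n (≰⇒> 2≰Cu)) (marked≤1 u) (marked-empty u)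
    charge′ (yes 2≤Cu) = begin
      2 * C u + 3 * marked u ≡⟨ cong (λ m → 2 * C u + 3 * m) unmarked ⟩
      2 * C u + 0            ≡⟨ +-identityʳ (2 * C u) ⟩
      2 * C u                ≤⟨ *-monoʳ-≤ 2 (at-most-3 u) ⟩
      6                      ∎
      where
      open ≤-Reasoning
      unmarked : marked u ≡ 0
      unmarked = n<1⇒n≡0 (≰⇒> λ 1≤m → contradiction (subst (2 ≤_) (marked-empty u 1≤m) 2≤Cu) λ ())

  heavyMatching⇒bound : 2 * size C + 3 ≤ 3 * n
  heavyMatching⇒bound = +-cancelʳ-≤ (3 * h) _ _ (begin
    2 * size C + 3 + 3 * h                              ≡⟨ regroup (2 * size C) h ⟩
    2 * size C + 3 * (h + 1)                            ≡⟨ cong (λ x → 2 * size C + 3 * x) size-marked ⟨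
    2 * size C + 3 * size marked                        ≡⟨ cong₂ _+_ (size-scale 2 C) (size-scale 3 marked) ⟨
    size (λ u → 2 * C u) + size (λ u → 3 * marked u)    ≡⟨ ∑-distrib-+ (λ u → 2 * C u) (λ u → 3 * marked u) ⟨
    size (λ u → 2 * C u + 3 * marked u)                 ≤⟨ size-mono {f = λ u → 2 * C u + 3 * marked u} charge ⟩
    size (λ u → 3 + 3 * heavy u)                        ≡⟨ ∑-distrib-+ {n} (λ _ → 3) (λ u → 3 * heavy u) ⟩
    size {n} (λ _ → 3) + size (λ u → 3 * heavy u)       ≡⟨ cong₂ _+_ (size-const n 3) (size-scale 3 heavy) ⟩
    n * 3 + 3 * h                                       ≡⟨ cong (_+ 3 * h) (*-comm n 3) ⟩
    3 * n + 3 * h                                       ∎)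
    where
    open ≤-Reasoning
    regroup : ∀ x y → x + 3 + 3 * y ≡ x + 3 * (y + 1)
    regroup = solve-∀
    heavy : Fin n → ℕ
    heavy v = indicator (2 ≤? C v)
    h = size heavy
    size-marked : size marked ≡ h + 1
    size-marked = begin-equality
      size marked                                             ≡⟨ ∑-distrib-+ image _ ⟩
      size image + size (λ u → indicator (u ≟ r))             ≡⟨ cong₂ _+_ (∑-comm (λ u v → is-partner u (2 ≤? C v))) (size-indicator r) ⟩
      size (λ v → size (λ u → is-partner u (2 ≤? C v))) + 1   ≡⟨ cong (_+ 1) (sum-cong-≗ λ v → size-is-partner (2 ≤? C v)) ⟩
      h + 1                                                   ∎

unsolvable⇒heavyMatching : {D : Digraph n} → StrongDiameter2 D → {r : Fin n} {C : Config n} →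
                           ¬ Solvable D r C → HeavyMatching C r
unsolvable⇒heavyMatching {D = D} diam {r} {C} ¬sol = record
  { root-empty        = root-empty
  ; at-most-3         = at-most-3
  ; partner           = proj₁ ∘ route
  ; partner-empty     = partner-empty
  ; partner-≢root     = λ p → arc⇒≢ D (proj₂ (proj₂ (route p)))
  ; partner-injective = partner-injective
  }
  where
  root-empty : C r ≡ 0
  root-empty = n<1⇒n≡0 (≰⇒> (¬sol ∘ solvable-here D r))

  route : ∀ {v} → 2 ≤ C v → ∃ λ k → Arc D v k × Arc D k r
  route {v} 2≤Cv with diam v r (λ { refl → contradiction (subst (2 ≤_) root-empty 2≤Cv) λ () })
  ... | inj₁ v→r  = contradiction (solvable-by-arc D r v→r 2≤Cv) ¬sol
  ... | inj₂ path = path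

  at-most-3 : ∀ v → C v ≤ 3
  at-most-3 v = ≮⇒≥ λ 4≤Cv →
    let (_ , v→k , k→r) = route (≤-trans (s≤s (s≤s z≤n)) 4≤Cv) in ¬sol (solvable-by-path-4 D r v→k k→r 4≤Cv)

  partner-empty : ∀ {v} (p : 2 ≤ C v) → C (proj₁ (route p)) ≡ 0
  partner-empty p = let (_ , v→k , k→r) = route p in
    n<1⇒n≡0 (≰⇒> λ 1≤Ck → ¬sol (solvable-by-path D r v→k k→r p 1≤Ck))

  partner-injective : ∀ {v w} (p : 2 ≤ C v) (q : 2 ≤ C w) → proj₁ (route p) ≡ proj₁ (route q) → v ≡ w
  partner-injective {v} {w} p q k≡k′ with v ≟ w
  ... | yes v≡w = v≡w
  ... | no v≢w  = let (_ , v→k , k→r) = route p ; (_ , w→k′ , _) = route q in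
    contradiction (solvable-by-merge D r v≢w v→k (subst (Arc D w) (sym k≡k′) w→k′) k→r p q) ¬sol

diameter2⇒solvable : {D : Digraph n} → StrongDiameter2 D → {r : Fin n} {C : Config n} →
                     3 * n ≤ 2 * size C + 2 → Solvable D r C
diameter2⇒solvable {D = D} diam {r} {C} 3n≤ with solvable? D r C
... | yes sol = sol
... | no ¬sol = contradiction (+-cancelˡ-≤ (2 * size C) 3 2
                  (≤-trans (heavyMatching⇒bound (unsolvable⇒heavyMatching diam ¬sol)) 3n≤)) λ { (s≤s (s≤s ())) }

diameter2⇒allSolvable : {D : Digraph n} → StrongDiameter2 D → ∀ {s} → 3 * n ≤ 2 * s + 2 → AllSolvable D s
diameter2⇒allSolvable diam 3n≤ C refl r = diameter2⇒solvable diam 3n≤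

∃2T<m≤2T+2 : ∀ m → 1 ≤ m → ∃ λ T → 2 * T < m × m ≤ 2 * T + 2
∃2T<m≤2T+2 1 _ = 0 , s≤s z≤n , s≤s z≤n
∃2T<m≤2T+2 2 _ = 0 , s≤s z≤n , ≤-refl
∃2T<m≤2T+2 (suc (suc m@(suc _))) _ with ∃2T<m≤2T+2 m (s≤s z≤n)
... | T , 2T<m , m≤2T+2 = suc T , subst (_< 2 + m) (sym (*-suc 2 T)) (s≤s (s≤s 2T<m))
                                , subst (λ x → 2 + m ≤ x + 2) (sym (*-suc 2 T)) (s≤s (s≤s m≤2T+2))

diameter2⇒pebblingNumber : 1 ≤ n → {D : Digraph n} → StrongDiameter2 D → ∃ λ t → IsPebblingNumber D t × 2 * t < 3 * n
diameter2⇒pebblingNumber {n} 1≤n {D} diam with ∃2T<m≤2T+2 (3 * n) (≤-trans 1≤n (m≤m+n n _))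
... | T , 2T<3n , 3n≤2T+2 with least-below (AllSolvable D) (allSolvable? D) T (T , ≤-refl , diameter2⇒allSolvable diam 3n≤2T+2)
... | t , t≤T , least = t , least , ≤-<-trans (*-monoʳ-≤ 2 t≤T) 2T<3n

record Stuck (D : Digraph n) (r : Fin n) (C : Config n) : Set where
  field
    root-empty    : C r ≡ 0
    heavy≤3       : ∀ {v} → 2 ≤ C v → C v ≤ 3
    heavy-out     : ∀ {v w} → 2 ≤ C v → Arc D v w → C w ≡ 0 × w ≢ r
    heavy-private : ∀ {u v w} → 2 ≤ C u → Arc D u w → 2 ≤ C v → Arc D v w → u ≡ v

module _ {D : Digraph n} {r : Fin n} where

  stuck-mono : {C C′ : Config n} → Stuck D r C → (∀ v → C′ v ≤ C v) → Stuck D r C′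
  stuck-mono {C} {C′} S C′≤C = record
    { root-empty    = n≤0⇒n≡0 (subst (_ ≤_) root-empty (C′≤C r))
    ; heavy≤3       = λ p → ≤-trans (C′≤C _) (heavy≤3 (lift p))
    ; heavy-out     = λ p v→w → let (Cw≡0 , w≢r) = heavy-out (lift p) v→w in
                                n≤0⇒n≡0 (subst (_ ≤_) Cw≡0 (C′≤C _)) , w≢r
    ; heavy-private = λ p u→w q v→w → heavy-private (lift p) u→w (lift q) v→w
    }
    where
    open Stuck S
    lift : ∀ {v} → 2 ≤ C′ v → 2 ≤ C v
    lift p = ≤-trans p (C′≤C _)

  -- The move i → j leaves at most one pebble on i and exactly one on the empty
  -- vertex j, so the heavy vertices of the new configuration are old ones, untouched.
  stuck-update : {C : Config n} {i j : Fin n} → Stuck D r C → Arc D i j → 2 ≤ C i → Stuck D r (update C i j)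
  stuck-update {C} {i} {j} S i→j 2≤Ci = record
    { root-empty    = trans (update-other C i j {r} (light⇒≢ (subst (_≤ 1) (sym root-empty) z≤n) ∘ sym) (j≢r ∘ sym)) root-empty
    ; heavy≤3       = λ {v} p → subst (_≤ 3) (sym (unchanged {v} p)) (heavy≤3 (old {v} p))
    ; heavy-out     = λ {v} {w} p v→w →
        let (Cw≡0 , w≢r) = heavy-out (old {v} p) v→w
            w≢i = light⇒≢ (subst (_≤ 1) (sym Cw≡0) z≤n) ∘ sym
            w≢j = λ { refl → proj₁ (new⇒≢ {v} p) (heavy-private (old {v} p) v→w 2≤Ci i→j) }
        in trans (update-other C i j w≢i w≢j) Cw≡0 , w≢r
    ; heavy-private = λ {u} {v} p u→w q v→w → heavy-private (old {u} p) u→w (old {v} q) v→w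
    }
    where
    open Stuck S
    U = update C i j
    Cj≡0 = proj₁ (heavy-out 2≤Ci i→j)
    j≢r  = proj₂ (heavy-out 2≤Ci i→j)

    light⇒≢ : ∀ {v} → C v ≤ 1 → i ≢ v
    light⇒≢ Cv≤1 refl = contradiction (≤-trans 2≤Ci Cv≤1) (n≮n 1)

    new⇒≢ : ∀ {v} → 2 ≤ U v → v ≢ i × v ≢ j
    new⇒≢ p = (λ { refl → contradiction (≤-trans p (subst (_≤ 1) (sym (update-source C i j)) (∸-monoˡ-≤ 2 (heavy≤3 2≤Ci)))) (n≮n 1) })
            , (λ { refl → contradiction (subst (2 ≤_) (trans (update-target C i j (arc⇒≢ D i→j)) (cong (_+ 1) Cj≡0)) p) (n≮n 1) })

    unchanged : ∀ {v} → 2 ≤ U v → U v ≡ C v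
    unchanged p = update-other C i j (proj₁ (new⇒≢ p)) (proj₂ (new⇒≢ p))

    old : ∀ {v} → 2 ≤ U v → 2 ≤ C v
    old p = subst (2 ≤_) (unchanged p) p

  stuck⇒unsolvable : {C : Config n} → Stuck D r C → ¬ Solvable D r C
  stuck⇒unsolvable S (_ , ε , 1≤Cr) = contradiction (subst (1 ≤_) (Stuck.root-empty S) 1≤Cr) λ ()
  stuck⇒unsolvable S (C′ , move _ i j i→j 2≤Ci ◅ moves , 1≤C′r) =
    stuck⇒unsolvable (stuck-update S i→j 2≤Ci) (C′ , moves , 1≤C′r)

-- The root is hub; it is entered only from the a i, and b i leaves only to a i.
module Sharpness (k : ℕ) where

  data Vertex : Set where
    hub : Vertex
    a b : Fin k → Vertex

  arcV : Vertex → Vertex → Bool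
  arcV hub   (b _) = true
  arcV (a _) hub   = true
  arcV (a i) (a j) = not ⌊ i ≟ j ⌋
  arcV (a _) (b _) = true
  arcV (b i) (a j) = ⌊ i ≟ j ⌋
  arcV _     _     = false

  arcV-loopless : ∀ x → arcV x x ≡ false
  arcV-loopless hub   = refl
  arcV-loopless (a i) with i ≟ i
  ... | yes _  = refl
  ... | no i≢i = contradiction refl i≢i
  arcV-loopless (b i) = refl

  a→a : ∀ {i j} → i ≢ j → T (arcV (a i) (a j))
  a→a {i} {j} i≢j = fromWitnessFalse {a? = i ≟ j} i≢j

  b→a : ∀ i → T (arcV (b i) (a i))
  b→a i = fromWitness {a? = i ≟ i} refl

  out-of-b : ∀ i y → T (arcV (b i) y) → y ≡ a i
  out-of-b i (a j) b→aj = cong a (sym (toWitness {a? = i ≟ j} b→aj))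

  diameterV : ∀ x y → x ≢ y → T (arcV x y) ⊎ ∃ λ z → T (arcV x z) × T (arcV z y)
  diameterV hub   hub   x≢y = contradiction refl x≢y
  diameterV hub   (a j) _   = inj₂ (b j , _ , b→a j)
  diameterV hub   (b j) _   = inj₁ _
  diameterV (a i) hub   _   = inj₁ _
  diameterV (a i) (a j) x≢y = inj₁ (a→a (x≢y ∘ cong a))
  diameterV (a i) (b j) _   = inj₁ _
  diameterV (b i) hub   _   = inj₂ (a i , b→a i , _)
  diameterV (b i) (a j) _ with i ≟ j
  ... | yes refl = inj₁ _
  ... | no i≢j   = inj₂ (a i , b→a i , a→a i≢j)
  diameterV (b i) (b j) _   = inj₂ (a i , b→a i , _)

  encode : Vertex → Fin (suc (k + k))
  encode hub   = zero
  encode (a i) = suc (i ↑ˡ k)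
  encode (b i) = suc (k ↑ʳ i)

  decode : Fin (suc (k + k)) → Vertex
  decode zero    = hub
  decode (suc x) = [ a , b ]′ (splitAt k x)

  decode-encode : ∀ x → decode (encode x) ≡ x
  decode-encode hub   = refl
  decode-encode (a i) = cong [ a , b ]′ (splitAt-↑ˡ k i k)
  decode-encode (b i) = cong [ a , b ]′ (splitAt-↑ʳ k k i)

  encode-decode : ∀ u → encode (decode u) ≡ u
  encode-decode zero    = refl
  encode-decode (suc x) = encode-[a,b] (splitAt k x) (join-splitAt k k x)
    where
    encode-[a,b] : ∀ s → join k k s ≡ x → encode ([ a , b ]′ s) ≡ suc x
    encode-[a,b] (inj₁ i) i↑ˡk≡x = cong suc i↑ˡk≡x
    encode-[a,b] (inj₂ i) k↑ʳi≡x = cong suc k↑ʳi≡x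

  decode-injective : ∀ {u w} → decode u ≡ decode w → u ≡ w
  decode-injective {u} {w} du≡dw = trans (sym (encode-decode u)) (trans (cong encode du≡dw) (encode-decode w))

  G : Digraph (suc (k + k))
  G = record { arc = λ u w → arcV (decode u) (decode w) ; loopless = arcV-loopless ∘ decode }

  diameter : StrongDiameter2 G
  diameter u w u≢w = Sum.map₂ via-encode (diameterV (decode u) (decode w) (u≢w ∘ decode-injective))
    where
    via-encode : (∃ λ z → T (arcV (decode u) z) × T (arcV z (decode w))) → ∃ λ v → Arc G u v × Arc G v w
    via-encode (z , u→z , z→w) = encode z , subst (T ∘ arcV (decode u)) (sym (decode-encode z)) u→z
                                          , subst (λ x → T (arcV x (decode w))) (sym (decode-encode z)) z→w

  weight : Vertex → ℕ
  weight (b _) = 3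
  weight _     = 0

  weight≤3 : ∀ x → weight x ≤ 3
  weight≤3 hub   = z≤n
  weight≤3 (a _) = z≤n
  weight≤3 (b _) = ≤-refl

  heavy⇒b : ∀ x → 2 ≤ weight x → ∃ λ i → x ≡ b i
  heavy⇒b (b i) _ = i , refl

  C₀ : Config (suc (k + k))
  C₀ = weight ∘ decode

  size-C₀ : size C₀ ≡ k * 3
  size-C₀ = begin
    size (C₀ ∘ suc)                                          ≡⟨ size-↑ k k (C₀ ∘ suc) ⟩
    size (C₀ ∘ suc ∘ (_↑ˡ k)) + size (C₀ ∘ suc ∘ (k ↑ʳ_))    ≡⟨ cong₂ _+_ (size-zero (C₀ ∘ suc ∘ (_↑ˡ k)) (cong weight ∘ decode-encode ∘ a))
                                                                          (sum-cong-≗ (cong weight ∘ decode-encode ∘ b)) ⟩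
    0 + size {k} (λ _ → 3)                                   ≡⟨ size-const k 3 ⟩
    k * 3                                                    ∎
    where open ≡-Reasoning

  heavy-arc : ∀ v w → 2 ≤ C₀ v → Arc G v w → ∃ λ i → decode v ≡ b i × decode w ≡ a i
  heavy-arc v w 2≤C₀v v→w =
    let (i , dv≡bi) = heavy⇒b (decode v) 2≤C₀v
    in i , dv≡bi , out-of-b i (decode w) (subst (λ x → T (arcV x (decode w))) dv≡bi v→w)

  stuck : Stuck G zero C₀
  stuck = record
    { root-empty    = refl
    ; heavy≤3       = λ {v} _ → weight≤3 (decode v)
    ; heavy-out     = λ {v} {w} p v→w → let (_ , _ , dw≡ai) = heavy-arc v w p v→w in cong weight dw≡ai , hub≢ w dw≡ai
    ; heavy-private = λ {u} {v} {w} → unique-heavy-in u v w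
    }
    where
    hub≢ : ∀ w {i} → decode w ≡ a i → w ≢ zero
    hub≢ _ () refl

    unique-heavy-in : ∀ u v w → 2 ≤ C₀ u → Arc G u w → 2 ≤ C₀ v → Arc G v w → u ≡ v
    unique-heavy-in u v w p u→w q v→w with heavy-arc u w p u→w | heavy-arc v w q v→w
    ... | i , du≡bi , dw≡ai | j , dv≡bj , dw≡aj with trans (sym dw≡ai) dw≡aj
    ... | refl = decode-injective (trans du≡bi (sym dv≡bj))

  below-unsolvable : ∀ s → s < 3 * k + 1 → ¬ AllSolvable G s
  below-unsolvable s s<3k+1 all =
    let s≤ΣC₀ = subst (s ≤_) (trans (*-comm 3 k) (sym size-C₀)) (m<1+n⇒m≤n (subst (s <_) (+-comm (3 * k) 1) s<3k+1))
        (C , ΣC≡s , C≤C₀) = ∃-subconfig C₀ s s≤ΣC₀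
    in stuck⇒unsolvable (stuck-mono stuck C≤C₀) (all C ΣC≡s zero)

  pebblingNumber : IsPebblingNumber G (3 * k + 1)
  pebblingNumber = diameter2⇒allSolvable diameter (≤-trans (m≤m+n _ 1) (≤-reflexive (order k))) , below-unsolvable
    where
    order : ∀ k → 3 * suc (k + k) + 1 ≡ 2 * (3 * k + 1) + 2
    order = solve-∀

theorem3 : ((n : ℕ) → 1 ≤ n → (D : Digraph n) → StrongDiameter2 D → ∃ λ t → IsPebblingNumber D t × 2 * t < 3 * n)
    × ((k : ℕ) → 1 ≤ k → Σ (Digraph (2 * k + 1)) λ D → StrongDiameter2 D × IsPebblingNumber D (3 * k + 1))
theorem3 = (λ n 1≤n D diam → diameter2⇒pebblingNumber 1≤n diam)
         , λ k _ → subst (λ m → Σ (Digraph m) λ D → StrongDiameter2 D × IsPebblingNumber D (3 * k + 1))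
                         (order k) (Sharpness.G k , Sharpness.diameter k , Sharpness.pebblingNumber k)
  where
  order : ∀ k → suc (k + k) ≡ 2 * k + 1
  order = solve-∀
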